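{- Let $\mathcal{R}$ be a finite valuation ring of order $q^r$ and let $\mathcal{E}\subseteq\mathcal{R}^2$. If $q^{2r-1}=o(|\mathcal{E}|)$, then there exists $\mathbf{z}\in\mathcal{E}$ such that $|V_2^{\mathbf{z}}(\mathcal{E})|=(1-o(1))q^r$, where \[V_2^{\mathbf{z}}(\mathcal{E})=\{\det(\mathbf{x}^1-\mathbf{z},\mathbf{x}^2-\mathbf{z})\colon \mathbf{x}^1,\mathbf{x}^2\in\mathcal{E}\}.\]
   Context: $\mathcal{R}$ is a finite valuation ring: a finite commutative local ring with identity whose ideals are totally ordered by inclusion (a finite chain ring); its residue field has $q$ elements, $q$ an odd prime power, and $|\mathcal{R}|=q^r$. $\det(\mathbf{u},\mathbf{v})$ is the determinant of the $2\times2$ matrix with columns $\mathbf{u},\mathbf{v}$. $X=o(Y)$ means $X/Y\to0$ as $q\to\infty$, and $o(1)$ denotes a quantity tending to $0$ as $q\to\infty$. -}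

module Defs where

open import Data.Nat using (ℕ; suc; _*_; _^_; _≤_)
open import Data.Nat.Primality using (Prime)
open import Data.Nat.Divisibility using (_∣_)
open import Data.Bool using (Bool; true; false; not; _∧_)
import Data.Bool
open import Data.Fin using (Fin)
open import Data.Fin.Properties using (any?) renaming (_≟_ to _≟F_)
open import Data.Fin.Subset using (Subset; _∈_; _⊆_; ∣_∣)
open import Data.Vec using (tabulate)
open import Data.List using (map; allFin)
open import Data.Nat.ListAction using (sum)
open import Data.Product using (_×_; ∃; ∃₂; _,_)
open import Data.Sum using (_⊎_)
open import Relation.Nullary using (¬_; Dec)
open import Relation.Nullary.Decidable using (⌊_⌋; _×-dec_)
open import Relation.Binary.PropositionalEquality using (_≡_; _≢_)
open import Algebra.Structures using (IsCommutativeRing)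

record FinCommRing (N : ℕ) : Set where
  infixl 6 _+ᴿ_ _-ᴿ_
  infixl 7 _*ᴿ_
  field
    _+ᴿ_ _*ᴿ_ : Fin N → Fin N → Fin N
    -ᴿ_      : Fin N → Fin N
    0# 1#   : Fin N
    isCommutativeRing : IsCommutativeRing _≡_ _+ᴿ_ _*ᴿ_ -ᴿ_ 0# 1#

  _-ᴿ_ : Fin N → Fin N → Fin N
  a -ᴿ b = a +ᴿ (-ᴿ b)

  nonUnits : Subset N
  nonUnits = tabulate (λ a → not ⌊ any? (λ b → (a *ᴿ b) ≟F 1#) ⌋)

  IsIdeal : Subset N → Set
  IsIdeal I = (0# ∈ I)
            × (∀ a b → a ∈ I → b ∈ I → (a +ᴿ b) ∈ I)
            × (∀ c a → a ∈ I → (c *ᴿ a) ∈ I)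

open FinCommRing public

-- R is a finite valuation ring (finite local chain ring) with residue field
-- of q elements, q odd prime power, and |R| = q ^ r.
record IsFiniteValuationRing {N : ℕ} (R : FinCommRing N) (q r : ℕ) : Set where
  field
    nontrivial : 0# R ≢ 1# R
    local      : IsIdeal R (nonUnits R)            -- unique maximal ideal m = non-units
    chain      : ∀ I J → IsIdeal R I → IsIdeal R J → I ⊆ J ⊎ J ⊆ I
    residue    : q * ∣ nonUnits R ∣ ≡ N            -- |R / m| = q
    order      : N ≡ q ^ r
    qPrimePow  : ∃₂ λ p k → Prime p × q ≡ p ^ suc k
    qOdd       : ¬ (2 ∣ q)

Subset² : ℕ → Set
Subset² N = Fin N → Fin N → Bool

card² : ∀ {N} → Subset² N → ℕ
card² {N} E = sum (map (λ a → ∣ tabulate (E a) ∣) (allFin N))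

det : ∀ {N} (R : FinCommRing N) → Fin N → Fin N → Fin N → Fin N → Fin N
det R u1 u2 v1 v2 = _-ᴿ_ R (_*ᴿ_ R u1 v2) (_*ᴿ_ R u2 v1)

V₂ : ∀ {N} (R : FinCommRing N) → Subset² N → Fin N → Fin N → Subset N
V₂ R E z1 z2 = tabulate λ t →
  ⌊ any? (λ a → any? (λ b → any? (λ c → any? (λ d →
      ((E a b ∧ E c d) Data.Bool.≟ true) ×-dec
      (det R (_-ᴿ_ R a z1) (_-ᴿ_ R b z2) (_-ᴿ_ R c z1) (_-ᴿ_ R d z2) ≟F t))))) ⌋

-- For a slope s, sort the points of E by the line of slope s through them, i.e. by the
-- intercept t = b − s·a of (a, b).  Let lines s be the number of these lines meeting E and
-- collisions s the number of ordered pairs of points of E on a common one; Cauchy–Schwarz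
-- gives |E|² ≤ lines s · collisions s.  If z, x ∈ E lie on a common line of slope s and
-- u = x₁ − z₁ is a unit, then det(x − z, y − z) = u·(t_y − t_z) is a bijective function of
-- the intercept t_y of y, so |V₂ᶻ(E)| ≥ lines s.  A collision whose first coordinates differ
-- by a unit determines its slope, so over all slopes there are at most |E|² of those, while
-- for a fixed slope the remaining collisions number at most |E|·|𝔪|, 𝔪 the non-units.
-- Averaging over the |R| slopes, |E| ≥ (k+2)|𝔪||R| forces a slope with a unit collision and
-- with k|R| · collisions s ≤ (k+1)|E|², whence k|R| ≤ (k+1)|V₂ᶻ(E)|.  For a finite valuation
-- ring |𝔪||R| = q^(2r−1); the argument needs no lower bound on q, so the threshold Q is 0.

module Submission where

open import Defs
open import Data.Nat using (ℕ; suc; _*_; _^_; _≤_; _∸_)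
open import Data.Bool using (true)
open import Data.Fin.Subset using (∣_∣)
open import Data.Product using (_×_; ∃₂)
open import Relation.Binary.PropositionalEquality using (_≡_)

open import Algebra.Bundles using (CommutativeRing)
open import Algebra.Solver.Ring.AlmostCommutativeRing using (fromCommutativeRing)
open import Data.Bool using (Bool; false; not; _∧_)
open import Data.Bool.Properties using (T-≡)
open import Data.Fin using (Fin; zero; suc)
open import Data.Fin.Properties using (_≟_; any?; nonZeroIndex)
import Data.Fin.Permutation as Perm
open import Data.Fin.Subset using (Subset)
import Data.List as List
open import Data.List.Properties using (map-tabulate)
open import Data.Nat using (zero; _+_; _<_; _<ᵇ_; _≤?_; z≤n; s≤s; NonZero; >-nonZero; >-nonZero⁻¹)
open import Data.Nat.ListAction using () renaming (sum to sumᴸ)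
open import Data.Nat.Properties hiding (_≟_)
open import Data.Nat.Tactic.RingSolver using (solve-∀)
open import Data.Product using (∃; _,_; proj₁; proj₂)
open import Data.Sum using ([_,_]′)
open import Data.Vec using ([]; _∷_; lookup; tabulate)
open import Data.Vec.Properties using (lookup∘tabulate)
open import Function using (id; Equivalence)
open import Level using (0ℓ)
open import Relation.Binary.PropositionalEquality
  using (refl; sym; trans; cong; cong₂; subst; subst₂; module ≡-Reasoning)
open import Relation.Nullary using (¬_; yes; no; contradiction)
open import Relation.Nullary.Decidable using (⌊_⌋; fromWitness; _×-dec_)
open import Algebra.Properties.Semiring.Sum +-*-semiring
  using (sum; sum-cong-≗; sum-replicate-zero; ∑-distrib-+; ∑-comm; ∑-permute; *-distribˡ-sum; *-distribʳ-sum)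

-- Finite sums of natural numbers

𝟙 : Bool → ℕ
𝟙 true  = 1
𝟙 false = 0

𝟙≤1 : ∀ b → 𝟙 b ≤ 1
𝟙≤1 true  = ≤-refl
𝟙≤1 false = z≤n

𝟙-pos⇒true : ∀ {b} → 0 < 𝟙 b → b ≡ true
𝟙-pos⇒true {true} _ = refl

𝟙-split : ∀ b n → 𝟙 b * n + 𝟙 (not b) * n ≡ n
𝟙-split true  n = trans (+-identityʳ (n + 0)) (+-identityʳ n)
𝟙-split false n = +-identityʳ n

δ : ∀ {n} → Fin n → Fin n → ℕ
δ x y = 𝟙 ⌊ x ≟ y ⌋

δ-suc : ∀ {n} (x y : Fin n) → δ (suc x) (suc y) ≡ δ x y
δ-suc x y with x ≟ y
... | yes _ = refl
... | no  _ = refl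

δ-pos⇒≡ : ∀ {n} {x y : Fin n} → 0 < δ x y → x ≡ y
δ-pos⇒≡ {x = x} {y} δ>0 with x ≟ y
... | yes x≡y = x≡y

δ-mono : ∀ {n} {x y u v : Fin n} → (x ≡ y → u ≡ v) → δ x y ≤ δ u v
δ-mono {x = x} {y} {u} {v} imp with x ≟ y | u ≟ v
... | yes x≡y | no u≢v = contradiction (imp x≡y) u≢v
... | yes _ | yes _ = ≤-refl
... | no  _ | _     = z≤n

sum-mono-≤ : ∀ {n} {f g : Fin n → ℕ} → (∀ i → f i ≤ g i) → sum f ≤ sum g
sum-mono-≤ {zero}  f≤g = z≤n
sum-mono-≤ {suc n} f≤g = +-mono-≤ (f≤g zero) (sum-mono-≤ (λ i → f≤g (suc i)))

sum-const : ∀ n c → sum {n} (λ _ → c) ≡ n * c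
sum-const zero    c = refl
sum-const (suc n) c = cong (c +_) (sum-const n c)

sum-pos⇒∃-pos : ∀ {n} (f : Fin n → ℕ) → 0 < sum f → ∃ λ i → 0 < f i
sum-pos⇒∃-pos {suc n} f ∑f>0 with f zero in f₀≡
... | suc _ = zero , subst (0 <_) (sym f₀≡) (s≤s z≤n)
... | zero  with sum-pos⇒∃-pos (λ i → f (suc i)) ∑f>0
...   | i , fᵢ>0 = suc i , fᵢ>0

sum-*-sum : ∀ {m n} (f : Fin m → ℕ) (g : Fin n → ℕ) →
            sum f * sum g ≡ sum (λ i → sum (λ j → f i * g j))
sum-*-sum f g = trans (*-distribʳ-sum (sum g) f) (sum-cong-≗ (λ i → *-distribˡ-sum (f i) g))

sum-bijection : ∀ {n} (f : Fin n → ℕ) (σ τ : Fin n → Fin n) →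
                (∀ y → σ (τ y) ≡ y) → (∀ x → τ (σ x) ≡ x) → sum (λ i → f (σ i)) ≡ sum f
sum-bijection f σ τ στ τσ = sym (∑-permute f (Perm.permutation σ τ στ τσ))

∑-δ : ∀ {n} (x : Fin n) → sum (δ x) ≡ 1
∑-δ {suc n} zero    = cong suc (sum-replicate-zero n)
∑-δ {suc n} (suc x) = trans (sum-cong-≗ (δ-suc x)) (∑-δ x)

∑-δ*δ : ∀ {n} (u v : Fin n) → sum (λ t → δ u t * δ v t) ≡ δ u v
∑-δ*δ {n} u v with u ≟ v
... | yes refl = trans (sum-cong-≗ (λ t → 𝟙*𝟙 ⌊ u ≟ t ⌋)) (∑-δ u)
  where
  𝟙*𝟙 : ∀ b → 𝟙 b * 𝟙 b ≡ 𝟙 b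
  𝟙*𝟙 true  = refl
  𝟙*𝟙 false = refl
... | no u≢v = trans (sum-cong-≗ disjoint) (sum-replicate-zero n)
  where
  disjoint : ∀ t → δ u t * δ v t ≡ 0
  disjoint t with u ≟ t | v ≟ t
  ... | yes refl | yes refl = contradiction refl u≢v
  ... | yes _    | no _     = refl
  ... | no _     | _        = refl

sumᴸ-tabulate : ∀ {n} (f : Fin n → ℕ) → sumᴸ (List.tabulate f) ≡ sum f
sumᴸ-tabulate {zero}  f = refl
sumᴸ-tabulate {suc n} f = cong (f zero +_) (sumᴸ-tabulate (λ i → f (suc i)))

∣p∣≡∑𝟙p : ∀ {n} (p : Subset n) → ∣ p ∣ ≡ sum (λ i → 𝟙 (lookup p i))
∣p∣≡∑𝟙p []          = refl
∣p∣≡∑𝟙p (true ∷ p)  = cong suc (∣p∣≡∑𝟙p p)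
∣p∣≡∑𝟙p (false ∷ p) = ∣p∣≡∑𝟙p p

m*n>0⇒m>0×n>0 : ∀ m n → 0 < m * n → 0 < m × 0 < n
m*n>0⇒m>0×n>0 (suc m) (suc n) _ = s≤s z≤n , s≤s z≤n
m*n>0⇒m>0×n>0 (suc m) zero mn>0 = contradiction (subst (0 <_) (*-zeroʳ m) mn>0) (<-irrefl refl)

2xy≤x²+y² : ∀ x y → 2 * (x * y) ≤ x * x + y * y
2xy≤x²+y² x y = [ ordered , (λ y≤x → subst₂ _≤_ (cong (2 *_) (*-comm y x)) (+-comm (y * y) (x * x)) (ordered y≤x)) ]′
                (≤-total x y)
  where
  identity : ∀ a d → 2 * (a * (a + d)) + d * d ≡ a * a + (a + d) * (a + d)
  identity = solve-∀
  ordered : ∀ {a b} → a ≤ b → 2 * (a * b) ≤ a * a + b * b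
  ordered {a} {b} a≤b = subst (λ c → 2 * (a * c) ≤ a * a + c * c) (m+[n∸m]≡n a≤b)
                              (subst (2 * (a * (a + (b ∸ a))) ≤_) (identity a (b ∸ a)) (m≤m+n _ _))

cauchy-schwarz : ∀ {n} (a b : Fin n → ℕ) →
                 sum (λ i → a i * b i) * sum (λ i → a i * b i) ≤ sum (λ i → a i * a i) * sum (λ i → b i * b i)
cauchy-schwarz {n} a b = *-cancelˡ-≤ 2 (begin
  2 * (sum ab * sum ab)
    ≡⟨ cong (2 *_) (sum-*-sum ab ab) ⟩
  2 * sum (λ i → sum (λ j → ab i * ab j))
    ≡⟨ double-*-distribˡ 2 (λ i j → ab i * ab j) ⟩
  sum (λ i → sum (λ j → 2 * (ab i * ab j)))
    ≤⟨ sum-mono-≤ (λ i → sum-mono-≤ (pointwise i)) ⟩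
  sum (λ i → sum (λ j → aa i * bb j + aa j * bb i))
    ≡⟨ double-distrib-+ (λ i j → aa i * bb j) (λ i j → aa j * bb i) ⟩
  sum (λ i → sum (λ j → aa i * bb j)) + sum (λ i → sum (λ j → aa j * bb i))
    ≡⟨ cong (sum (λ i → sum (λ j → aa i * bb j)) +_) (∑-comm (λ i j → aa j * bb i)) ⟩
  sum (λ i → sum (λ j → aa i * bb j)) + sum (λ j → sum (λ i → aa j * bb i))
    ≡⟨ cong₂ _+_ (sym (sum-*-sum aa bb)) (sym (sum-*-sum aa bb)) ⟩
  sum aa * sum bb + sum aa * sum bb
    ≡⟨ x+x≡2*x (sum aa * sum bb) ⟩
  2 * (sum aa * sum bb)
    ∎)
  where
  open ≤-Reasoning
  ab aa bb : Fin n → ℕ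
  ab i = a i * b i
  aa i = a i * a i
  bb i = b i * b i
  x+x≡2*x : ∀ x → x + x ≡ 2 * x
  x+x≡2*x = solve-∀
  lhs-identity : ∀ p q r s → 2 * ((p * s) * (r * q)) ≡ 2 * ((p * q) * (r * s))
  lhs-identity = solve-∀
  rhs-identity : ∀ p q r s → (p * s) * (p * s) + (r * q) * (r * q) ≡ (p * p) * (s * s) + (r * r) * (q * q)
  rhs-identity = solve-∀
  pointwise : ∀ i j → 2 * (ab i * ab j) ≤ aa i * bb j + aa j * bb i
  pointwise i j = subst₂ _≤_ (lhs-identity (a i) (b i) (a j) (b j)) (rhs-identity (a i) (b i) (a j) (b j))
                         (2xy≤x²+y² (a i * b j) (a j * b i))
  double-*-distribˡ : ∀ c (g : Fin n → Fin n → ℕ) →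
                      c * sum (λ i → sum (g i)) ≡ sum (λ i → sum (λ j → c * g i j))
  double-*-distribˡ c g = trans (*-distribˡ-sum c (λ i → sum (g i))) (sum-cong-≗ (λ i → *-distribˡ-sum c (g i)))
  double-distrib-+ : ∀ (g h : Fin n → Fin n → ℕ) →
                     sum (λ i → sum (λ j → g i j + h i j)) ≡ sum (λ i → sum (g i)) + sum (λ i → sum (h i))
  double-distrib-+ g h = trans (sum-cong-≗ (λ i → ∑-distrib-+ (g i) (h i))) (∑-distrib-+ (λ i → sum (g i)) (λ i → sum (h i)))

supportSize : ∀ {n} → (Fin n → ℕ) → ℕ
supportSize f = sum (λ i → 𝟙 (0 <ᵇ f i))

sum²≤supportSize*∑² : ∀ {n} (f : Fin n → ℕ) → sum f * sum f ≤ supportSize f * sum (λ i → f i * f i)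
sum²≤supportSize*∑² f =
  subst₂ _≤_ (cong₂ _*_ ∑𝟙f≡∑f ∑𝟙f≡∑f) (cong (_* sum (λ i → f i * f i)) (sum-cong-≗ (λ i → 𝟙²≡𝟙 (f i))))
         (cauchy-schwarz (λ i → 𝟙 (0 <ᵇ f i)) f)
  where
  𝟙*≡ : ∀ x → 𝟙 (0 <ᵇ x) * x ≡ x
  𝟙*≡ zero    = refl
  𝟙*≡ (suc x) = +-identityʳ (suc x)
  𝟙²≡𝟙 : ∀ x → 𝟙 (0 <ᵇ x) * 𝟙 (0 <ᵇ x) ≡ 𝟙 (0 <ᵇ x)
  𝟙²≡𝟙 zero    = refl
  𝟙²≡𝟙 (suc x) = refl
  ∑𝟙f≡∑f : sum (λ i → 𝟙 (0 <ᵇ f i) * f i) ≡ sum f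
  ∑𝟙f≡∑f = sum-cong-≗ (λ i → 𝟙*≡ (f i))

quadratic-cancel : ∀ k n e m → 0 < n →
                   n * (suc k * (e * e)) ≤ k * (n * (e * e)) + suc k * (n * (n * (e * m))) →
                   e ≤ suc k * (m * n)
quadratic-cancel k n e m n>0 averaged = e²≤e*b⇒e≤b e (*-cancelˡ-≤ n {{>-nonZero n>0}} n·e²≤)
  where
  lhs-split : ∀ k n e → n * (suc k * (e * e)) ≡ n * (e * e) + k * (n * (e * e))
  lhs-split = solve-∀
  rhs-regroup : ∀ k n e m → k * (n * (e * e)) + suc k * (n * (n * (e * m))) ≡
                            n * (e * (suc k * (m * n))) + k * (n * (e * e))
  rhs-regroup = solve-∀
  n·e²≤ : n * (e * e) ≤ n * (e * (suc k * (m * n)))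
  n·e²≤ = +-cancelʳ-≤ (k * (n * (e * e))) _ _ (subst₂ _≤_ (lhs-split k n e) (rhs-regroup k n e m) averaged)
  e²≤e*b⇒e≤b : ∀ e {b} → e * e ≤ e * b → e ≤ b
  e²≤e*b⇒e≤b zero    _   = z≤n
  e²≤e*b⇒e≤b (suc e) e²≤ = *-cancelˡ-≤ (suc e) e²≤

q*m≡q^r⇒m*q^r≡q^[2r∸1] : ∀ {q} m r .{{_ : NonZero q}} → q * m ≡ q ^ r → m * q ^ r ≡ q ^ (2 * r ∸ 1)
q*m≡q^r⇒m*q^r≡q^[2r∸1] {q} m zero    qm≡1 = cong (_* 1) (m*n≡1⇒n≡1 q m qm≡1)
q*m≡q^r⇒m*q^r≡q^[2r∸1] {q} m (suc r) qm≡q^r = begin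
  m * q ^ suc r       ≡⟨ cong (_* q ^ suc r) (*-cancelˡ-≡ m (q ^ r) q qm≡q^r) ⟩
  q ^ r * q ^ suc r   ≡⟨ ^-distribˡ-+-* q r (suc r) ⟨
  q ^ (r + suc r)     ≡⟨ cong (λ n → q ^ (r + suc n)) (+-identityʳ r) ⟨
  q ^ (2 * suc r ∸ 1) ∎
  where open ≡-Reasoning

-- Sums over the plane Fin n × Fin n

Point : ℕ → Set
Point n = Fin n × Fin n

∑ₚ : ∀ {n} → (Point n → ℕ) → ℕ
∑ₚ g = sum (λ a → sum (λ b → g (a , b)))

module _ {n : ℕ} where

  ∑ₚ-cong : {g h : Point n → ℕ} → (∀ x → g x ≡ h x) → ∑ₚ g ≡ ∑ₚ h
  ∑ₚ-cong g≡h = sum-cong-≗ (λ a → sum-cong-≗ (λ b → g≡h (a , b)))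

  ∑ₚ-mono-≤ : {g h : Point n → ℕ} → (∀ x → g x ≤ h x) → ∑ₚ g ≤ ∑ₚ h
  ∑ₚ-mono-≤ g≤h = sum-mono-≤ (λ a → sum-mono-≤ (λ b → g≤h (a , b)))

  ∑ₚ-distrib-+ : (g h : Point n → ℕ) → ∑ₚ (λ x → g x + h x) ≡ ∑ₚ g + ∑ₚ h
  ∑ₚ-distrib-+ g h = trans (sum-cong-≗ (λ a → ∑-distrib-+ (λ b → g (a , b)) (λ b → h (a , b))))
                           (∑-distrib-+ (λ a → sum (λ b → g (a , b))) (λ a → sum (λ b → h (a , b))))

  *-distribˡ-∑ₚ : ∀ c (g : Point n → ℕ) → c * ∑ₚ g ≡ ∑ₚ (λ x → c * g x)
  *-distribˡ-∑ₚ c g = trans (*-distribˡ-sum c (λ a → sum (λ b → g (a , b))))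
                            (sum-cong-≗ (λ a → *-distribˡ-sum c (λ b → g (a , b))))

  *-distribʳ-∑ₚ : ∀ c (g : Point n → ℕ) → ∑ₚ g * c ≡ ∑ₚ (λ x → g x * c)
  *-distribʳ-∑ₚ c g = trans (*-comm (∑ₚ g) c) (trans (*-distribˡ-∑ₚ c g) (∑ₚ-cong (λ x → *-comm c (g x))))

  ∑ₚ-*-∑ₚ : (g h : Point n → ℕ) → ∑ₚ g * ∑ₚ h ≡ ∑ₚ (λ x → ∑ₚ (λ y → g x * h y))
  ∑ₚ-*-∑ₚ g h = trans (*-distribʳ-∑ₚ (∑ₚ h) g) (∑ₚ-cong (λ x → *-distribˡ-∑ₚ (g x) h))

  ∑-∑ₚ-comm : ∀ {m} (g : Fin m → Point n → ℕ) → sum (λ i → ∑ₚ (g i)) ≡ ∑ₚ (λ x → sum (λ i → g i x))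
  ∑-∑ₚ-comm g = trans (∑-comm (λ i a → sum (λ b → g i (a , b))))
                      (sum-cong-≗ (λ a → ∑-comm (λ i b → g i (a , b))))

  ∑ₚ-pos⇒∃-pos : (g : Point n → ℕ) → 0 < ∑ₚ g → ∃ λ x → 0 < g x
  ∑ₚ-pos⇒∃-pos g ∑g>0 with sum-pos⇒∃-pos (λ a → sum (λ b → g (a , b))) ∑g>0
  ... | a , ∑gₐ>0 with sum-pos⇒∃-pos (λ b → g (a , b)) ∑gₐ>0
  ...   | b , gₐᵦ>0 = (a , b) , gₐᵦ>0

module AffineGeometry {N : ℕ} (R : FinCommRing N) where

  commutativeRing : CommutativeRing 0ℓ 0ℓ
  commutativeRing = record
    { Carrier = Fin N ; _≈_ = _≡_ ; _+_ = _+ᴿ_ R ; _*_ = _*ᴿ_ R ; -_ = -ᴿ_ R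
    ; 0# = 0# R ; 1# = 1# R ; isCommutativeRing = isCommutativeRing R }

  open CommutativeRing commutativeRing public
    using () renaming (_+_ to _+ᵣ_; _*_ to _*ᵣ_; -_ to -ᵣ_; _-_ to _-ᵣ_)
  open CommutativeRing commutativeRing
    using (ring; +-abelianGroup; +-commutativeMonoid)
    renaming ( *-assoc to *ᵣ-assoc; *-comm to *ᵣ-comm; *-identityˡ to *ᵣ-identityˡ; *-identityʳ to *ᵣ-identityʳ)
  open import Algebra.Properties.Ring ring using (x[y-z]≈xy-xz)
  open import Algebra.Properties.AbelianGroup +-abelianGroup
    using (//-rightDividesˡ; //-rightDividesʳ; ⁻¹-anti-homo‿-; x∙y⁻¹≈ε⇒x≈y; x≈y⇒x∙y⁻¹≈ε)
  open import Algebra.Solver.CommutativeMonoid +-commutativeMonoid using (solve; _⊕_; _⊜_)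
  open ≡-Reasoning

  isUnit : Fin N → Bool
  isUnit a = ⌊ any? (λ b → a *ᵣ b ≟ 1# R) ⌋

  isUnit⇒inverse : ∀ a → isUnit a ≡ true → ∃ λ i → a *ᵣ i ≡ 1# R
  isUnit⇒inverse a unit with any? (λ b → a *ᵣ b ≟ 1# R)
  ... | yes inverse = inverse

  sum-affine : ∀ (f : Fin N → ℕ) {u i} c → u *ᵣ i ≡ 1# R → sum (λ t → f (u *ᵣ (t -ᵣ c))) ≡ sum f
  sum-affine f {u} {i} c ui≡1 = sum-bijection f (λ t → u *ᵣ (t -ᵣ c)) (λ y → i *ᵣ y +ᵣ c) forward backward
    where
    unit-cancel : ∀ y → u *ᵣ (i *ᵣ y) ≡ y
    unit-cancel y = begin
      u *ᵣ (i *ᵣ y)  ≡⟨ *ᵣ-assoc u i y ⟨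
      (u *ᵣ i) *ᵣ y  ≡⟨ cong (_*ᵣ y) ui≡1 ⟩
      1# R *ᵣ y      ≡⟨ *ᵣ-identityˡ y ⟩
      y              ∎
    forward : ∀ y → u *ᵣ ((i *ᵣ y +ᵣ c) -ᵣ c) ≡ y
    forward y = trans (cong (u *ᵣ_) (//-rightDividesʳ c (i *ᵣ y))) (unit-cancel y)
    backward : ∀ t → i *ᵣ (u *ᵣ (t -ᵣ c)) +ᵣ c ≡ t
    backward t = begin
      i *ᵣ (u *ᵣ (t -ᵣ c)) +ᵣ c  ≡⟨ cong (λ w → i *ᵣ w +ᵣ c) (*ᵣ-comm u (t -ᵣ c)) ⟩
      i *ᵣ ((t -ᵣ c) *ᵣ u) +ᵣ c  ≡⟨ cong (_+ᵣ c) (*ᵣ-comm i ((t -ᵣ c) *ᵣ u)) ⟩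
      ((t -ᵣ c) *ᵣ u) *ᵣ i +ᵣ c  ≡⟨ cong (_+ᵣ c) (*ᵣ-assoc (t -ᵣ c) u i) ⟩
      (t -ᵣ c) *ᵣ (u *ᵣ i) +ᵣ c  ≡⟨ cong (λ w → (t -ᵣ c) *ᵣ w +ᵣ c) ui≡1 ⟩
      (t -ᵣ c) *ᵣ 1# R +ᵣ c      ≡⟨ cong (_+ᵣ c) (*ᵣ-identityʳ (t -ᵣ c)) ⟩
      (t -ᵣ c) +ᵣ c              ≡⟨ //-rightDividesˡ c t ⟩
      t                          ∎

  sum-translate : ∀ (f : Fin N → ℕ) c → sum (λ t → f (t -ᵣ c)) ≡ sum f
  sum-translate f c = trans (sum-cong-≗ (λ t → cong f (sym (*ᵣ-identityˡ (t -ᵣ c)))))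
                            (sum-affine f c (*ᵣ-identityˡ (1# R)))

  nonUnitCount : ∀ c → sum (λ a → 𝟙 (not (isUnit (a -ᵣ c)))) ≡ ∣ nonUnits R ∣
  nonUnitCount c = begin
    sum (λ a → 𝟙 (not (isUnit (a -ᵣ c))))  ≡⟨ sum-translate (λ a → 𝟙 (not (isUnit a))) c ⟩
    sum (λ a → 𝟙 (not (isUnit a)))         ≡⟨ sum-cong-≗ (λ a → cong 𝟙 (lookup∘tabulate (λ a → not (isUnit a)) a)) ⟨
    sum (λ a → 𝟙 (lookup (nonUnits R) a))  ≡⟨ ∣p∣≡∑𝟙p (nonUnits R) ⟨
    ∣ nonUnits R ∣                         ∎

  [x-y]-[z-w]≡[x-z]-[y-w] : ∀ x y z w → (x -ᵣ y) -ᵣ (z -ᵣ w) ≡ (x -ᵣ z) -ᵣ (y -ᵣ w)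
  [x-y]-[z-w]≡[x-z]-[y-w] x y z w = begin
    (x -ᵣ y) +ᵣ -ᵣ (z -ᵣ w)  ≡⟨ cong ((x -ᵣ y) +ᵣ_) (⁻¹-anti-homo‿- z w) ⟩
    (x -ᵣ y) +ᵣ (w -ᵣ z)     ≡⟨ solve 4 (λ x y′ w z′ → (x ⊕ y′) ⊕ (w ⊕ z′) ⊜ (x ⊕ z′) ⊕ (w ⊕ y′))
                                        refl x (-ᵣ y) w (-ᵣ z) ⟩
    (x -ᵣ z) +ᵣ (w -ᵣ y)     ≡⟨ cong ((x -ᵣ z) +ᵣ_) (⁻¹-anti-homo‿- y w) ⟨
    (x -ᵣ z) -ᵣ (y -ᵣ w)     ∎

  intercept : Fin N → Point N → Fin N
  intercept s (a , b) = b -ᵣ s *ᵣ a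

  on-line : ∀ s {a b t} → intercept s (a , b) ≡ t → t +ᵣ s *ᵣ a ≡ b
  on-line s {a} {b} refl = //-rightDividesˡ (s *ᵣ a) b

  rise≡slope*run : ∀ s {a b c d} → intercept s (a , b) ≡ intercept s (c , d) → b -ᵣ d ≡ s *ᵣ (a -ᵣ c)
  rise≡slope*run s {a} {b} {c} {d} same = begin
    b -ᵣ d               ≡⟨ x∙y⁻¹≈ε⇒x≈y (b -ᵣ d) (s *ᵣ a -ᵣ s *ᵣ c) difference≡0 ⟩
    s *ᵣ a -ᵣ s *ᵣ c     ≡⟨ x[y-z]≈xy-xz s a c ⟨
    s *ᵣ (a -ᵣ c)        ∎
    where
    difference≡0 : (b -ᵣ d) -ᵣ (s *ᵣ a -ᵣ s *ᵣ c) ≡ 0# R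
    difference≡0 = trans ([x-y]-[z-w]≡[x-z]-[y-w] b d (s *ᵣ a) (s *ᵣ c)) (x≈y⇒x∙y⁻¹≈ε same)

  slope-determined : ∀ s {a b c d i} → (a -ᵣ c) *ᵣ i ≡ 1# R →
                     intercept s (a , b) ≡ intercept s (c , d) → s ≡ (b -ᵣ d) *ᵣ i
  slope-determined s {a} {b} {c} {d} {i} inverse same = begin
    s                      ≡⟨ *ᵣ-identityʳ s ⟨
    s *ᵣ 1# R              ≡⟨ cong (s *ᵣ_) inverse ⟨
    s *ᵣ ((a -ᵣ c) *ᵣ i)   ≡⟨ *ᵣ-assoc s (a -ᵣ c) i ⟨
    (s *ᵣ (a -ᵣ c)) *ᵣ i   ≡⟨ cong (_*ᵣ i) (rise≡slope*run s same) ⟨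
    (b -ᵣ d) *ᵣ i          ∎

  det-along-line : ∀ s {a b c d} a′ b′ → intercept s (a , b) ≡ intercept s (c , d) →
                   det R (a -ᵣ c) (b -ᵣ d) (a′ -ᵣ c) (b′ -ᵣ d) ≡
                   (a -ᵣ c) *ᵣ (intercept s (a′ , b′) -ᵣ intercept s (c , d))
  det-along-line s {a} {b} {c} {d} a′ b′ same = begin
    (a -ᵣ c) *ᵣ (b′ -ᵣ d) -ᵣ (b -ᵣ d) *ᵣ (a′ -ᵣ c)
      ≡⟨ cong (λ w → (a -ᵣ c) *ᵣ (b′ -ᵣ d) -ᵣ w *ᵣ (a′ -ᵣ c)) (rise≡slope*run s same) ⟩
    (a -ᵣ c) *ᵣ (b′ -ᵣ d) -ᵣ (s *ᵣ (a -ᵣ c)) *ᵣ (a′ -ᵣ c)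
      ≡⟨ cong (λ w → (a -ᵣ c) *ᵣ (b′ -ᵣ d) -ᵣ w) swap-factors ⟩
    (a -ᵣ c) *ᵣ (b′ -ᵣ d) -ᵣ (a -ᵣ c) *ᵣ (s *ᵣ (a′ -ᵣ c))
      ≡⟨ x[y-z]≈xy-xz (a -ᵣ c) (b′ -ᵣ d) (s *ᵣ (a′ -ᵣ c)) ⟨
    (a -ᵣ c) *ᵣ ((b′ -ᵣ d) -ᵣ s *ᵣ (a′ -ᵣ c))
      ≡⟨ cong (λ w → (a -ᵣ c) *ᵣ ((b′ -ᵣ d) -ᵣ w)) (x[y-z]≈xy-xz s a′ c) ⟩
    (a -ᵣ c) *ᵣ ((b′ -ᵣ d) -ᵣ (s *ᵣ a′ -ᵣ s *ᵣ c))
      ≡⟨ cong ((a -ᵣ c) *ᵣ_) ([x-y]-[z-w]≡[x-z]-[y-w] b′ d (s *ᵣ a′) (s *ᵣ c)) ⟩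
    (a -ᵣ c) *ᵣ ((b′ -ᵣ s *ᵣ a′) -ᵣ (d -ᵣ s *ᵣ c))
      ∎
    where
    swap-factors : (s *ᵣ (a -ᵣ c)) *ᵣ (a′ -ᵣ c) ≡ (a -ᵣ c) *ᵣ (s *ᵣ (a′ -ᵣ c))
    swap-factors = trans (cong (_*ᵣ (a′ -ᵣ c)) (*ᵣ-comm s (a -ᵣ c))) (*ᵣ-assoc (a -ᵣ c) s (a′ -ᵣ c))


module Collisions {N : ℕ} (R : FinCommRing N) (E : Subset² N) where

  open AffineGeometry R

  ε : Point N → ℕ
  ε (a , b) = 𝟙 (E a b)

  e : ℕ
  e = ∑ₚ ε

  card²≡e : card² E ≡ e
  card²≡e = begin
    sumᴸ (List.map (λ a → ∣ tabulate (E a) ∣) (List.tabulate id))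
      ≡⟨ cong sumᴸ (map-tabulate id (λ a → ∣ tabulate (E a) ∣)) ⟩
    sumᴸ (List.tabulate (λ a → ∣ tabulate (E a) ∣))
      ≡⟨ sumᴸ-tabulate (λ a → ∣ tabulate (E a) ∣) ⟩
    sum (λ a → ∣ tabulate (E a) ∣)
      ≡⟨ sum-cong-≗ (λ a → ∣p∣≡∑𝟙p (tabulate (E a))) ⟩
    sum (λ a → sum (λ b → 𝟙 (lookup (tabulate (E a)) b)))
      ≡⟨ ∑ₚ-cong (λ (a , b) → cong 𝟙 (lookup∘tabulate (E a) b)) ⟩
    e
      ∎
    where open ≡-Reasoning

  fibre : Fin N → Fin N → ℕ
  fibre s t = ∑ₚ (λ x → ε x * δ (intercept s x) t)

  ∑-fibre≡e : ∀ s → sum (fibre s) ≡ e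
  ∑-fibre≡e s = trans (∑-∑ₚ-comm (λ t x → ε x * δ (intercept s x) t)) (∑ₚ-cong on-one-line)
    where
    on-one-line : ∀ x → sum (λ t → ε x * δ (intercept s x) t) ≡ ε x
    on-one-line x = begin
      sum (λ t → ε x * δ (intercept s x) t)  ≡⟨ *-distribˡ-sum (ε x) (δ (intercept s x)) ⟨
      ε x * sum (δ (intercept s x))          ≡⟨ cong (ε x *_) (∑-δ (intercept s x)) ⟩
      ε x * 1                                ≡⟨ *-identityʳ (ε x) ⟩
      ε x                                    ∎
      where open ≡-Reasoning

  collisions : Fin N → ℕ
  collisions s = sum (λ t → fibre s t * fibre s t)

  collinear : Fin N → Point N → Point N → ℕ
  collinear s z x = ε z * ε x * δ (intercept s z) (intercept s x)

  collisions≡∑collinear : ∀ s → collisions s ≡ ∑ₚ (λ z → ∑ₚ (λ x → collinear s z x))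
  collisions≡∑collinear s = begin
    sum (λ t → fibre s t * fibre s t)
      ≡⟨ sum-cong-≗ (λ t → ∑ₚ-*-∑ₚ (on t) (on t)) ⟩
    sum (λ t → ∑ₚ (λ z → ∑ₚ (λ x → on t z * on t x)))
      ≡⟨ ∑-∑ₚ-comm (λ t z → ∑ₚ (λ x → on t z * on t x)) ⟩
    ∑ₚ (λ z → sum (λ t → ∑ₚ (λ x → on t z * on t x)))
      ≡⟨ ∑ₚ-cong (λ z → ∑-∑ₚ-comm (λ t x → on t z * on t x)) ⟩
    ∑ₚ (λ z → ∑ₚ (λ x → sum (λ t → on t z * on t x)))
      ≡⟨ ∑ₚ-cong (λ z → ∑ₚ-cong (λ x → same-line z x)) ⟩
    ∑ₚ (λ z → ∑ₚ (λ x → collinear s z x))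
      ∎
    where
    open ≡-Reasoning
    on : Fin N → Point N → ℕ
    on t x = ε x * δ (intercept s x) t
    same-line : ∀ z x → sum (λ t → on t z * on t x) ≡ collinear s z x
    same-line z x = begin
      sum (λ t → on t z * on t x)
        ≡⟨ sum-cong-≗ (λ t → [m*n]*[o*p]≡[m*o]*[n*p] (ε z) (δ ℓz t) (ε x) (δ ℓx t)) ⟩
      sum (λ t → ε z * ε x * (δ ℓz t * δ ℓx t))
        ≡⟨ *-distribˡ-sum (ε z * ε x) (λ t → δ ℓz t * δ ℓx t) ⟨
      ε z * ε x * sum (λ t → δ ℓz t * δ ℓx t)
        ≡⟨ cong (ε z * ε x *_) (∑-δ*δ ℓz ℓx) ⟩
      collinear s z x
        ∎
      where
      ℓz = intercept s z
      ℓx = intercept s x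

  unitRun : Point N → Point N → Bool
  unitRun (c , _) (a , _) = isUnit (a -ᵣ c)

  unitPair nonUnitPair : Fin N → Point N → Point N → ℕ
  unitPair    s z x = 𝟙 (unitRun z x) * collinear s z x
  nonUnitPair s z x = 𝟙 (not (unitRun z x)) * collinear s z x

  unitCollisions nonUnitCollisions : Fin N → ℕ
  unitCollisions    s = ∑ₚ (λ z → ∑ₚ (unitPair s z))
  nonUnitCollisions s = ∑ₚ (λ z → ∑ₚ (nonUnitPair s z))

  collisions≡unit+nonUnit : ∀ s → collisions s ≡ unitCollisions s + nonUnitCollisions s
  collisions≡unit+nonUnit s = begin
    collisions s
      ≡⟨ collisions≡∑collinear s ⟩
    ∑ₚ (λ z → ∑ₚ (λ x → collinear s z x))
      ≡⟨ ∑ₚ-cong (λ z → ∑ₚ-cong (λ x → 𝟙-split (unitRun z x) _)) ⟨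
    ∑ₚ (λ z → ∑ₚ (λ x → unitPair s z x + nonUnitPair s z x))
      ≡⟨ ∑ₚ-cong (λ z → ∑ₚ-distrib-+ (unitPair s z) (nonUnitPair s z)) ⟩
    ∑ₚ (λ z → ∑ₚ (unitPair s z) + ∑ₚ (nonUnitPair s z))
      ≡⟨ ∑ₚ-distrib-+ (λ z → ∑ₚ (unitPair s z)) (λ z → ∑ₚ (nonUnitPair s z)) ⟩
    unitCollisions s + nonUnitCollisions s
      ∎
    where open ≡-Reasoning

  collinear-pos : ∀ s {c d a b} → 0 < collinear s (c , d) (a , b) →
                  E c d ≡ true × E a b ≡ true × intercept s (c , d) ≡ intercept s (a , b)
  collinear-pos s {c} {d} {a} {b} collinear>0 =
    let εε>0 , δ>0 = m*n>0⇒m>0×n>0 (𝟙 (E c d) * 𝟙 (E a b)) _ collinear>0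
        εz>0 , εx>0 = m*n>0⇒m>0×n>0 (𝟙 (E c d)) (𝟙 (E a b)) εε>0
    in  𝟙-pos⇒true εz>0 , 𝟙-pos⇒true εx>0 , δ-pos⇒≡ δ>0

  ∑-unitCollisions≤e² : sum unitCollisions ≤ e * e
  ∑-unitCollisions≤e² = begin
    sum unitCollisions
      ≡⟨ ∑-∑ₚ-comm (λ s z → ∑ₚ (unitPair s z)) ⟩
    ∑ₚ (λ z → sum (λ s → ∑ₚ (unitPair s z)))
      ≡⟨ ∑ₚ-cong (λ z → ∑-∑ₚ-comm (λ s → unitPair s z)) ⟩
    ∑ₚ (λ z → ∑ₚ (λ x → sum (λ s → unitPair s z x)))
      ≤⟨ ∑ₚ-mono-≤ (λ z → ∑ₚ-mono-≤ (λ x → one-slope z x)) ⟩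
    ∑ₚ (λ z → ∑ₚ (λ x → ε z * ε x))
      ≡⟨ ∑ₚ-*-∑ₚ ε ε ⟨
    e * e
      ∎
    where
    open ≤-Reasoning
    one-slope : ∀ z x → sum (λ s → unitPair s z x) ≤ ε z * ε x
    one-slope (c , d) (a , b) with isUnit (a -ᵣ c) in unit
    ... | false = subst (_≤ _) (sym (sum-replicate-zero N)) z≤n
    ... | true  with isUnit⇒inverse (a -ᵣ c) unit
    ...   | i , inverse = begin
      sum (λ s → 1 * collinear s z x)                  ≡⟨ sum-cong-≗ (λ s → *-identityˡ (collinear s z x)) ⟩
      sum (λ s → ε z * ε x * δ (intercept s z) (intercept s x))
                                                       ≤⟨ sum-mono-≤ (λ s → *-monoʳ-≤ (ε z * ε x) (δ-mono (slope s))) ⟩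
      sum (λ s → ε z * ε x * δ ((b -ᵣ d) *ᵣ i) s)      ≡⟨ *-distribˡ-sum (ε z * ε x) (δ ((b -ᵣ d) *ᵣ i)) ⟨
      ε z * ε x * sum (δ ((b -ᵣ d) *ᵣ i))              ≡⟨ cong (ε z * ε x *_) (∑-δ ((b -ᵣ d) *ᵣ i)) ⟩
      ε z * ε x * 1                                    ≡⟨ *-identityʳ (ε z * ε x) ⟩
      ε z * ε x                                        ∎
      where
      z x : Point N
      z = c , d
      x = a , b
      slope : ∀ s → intercept s z ≡ intercept s x → (b -ᵣ d) *ᵣ i ≡ s
      slope s same = sym (slope-determined s inverse (sym same))

  nonUnitCollisions≤e*m : ∀ s → nonUnitCollisions s ≤ e * ∣ nonUnits R ∣
  nonUnitCollisions≤e*m s = begin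
    nonUnitCollisions s                  ≤⟨ ∑ₚ-mono-≤ (λ z → ∑ₚ-mono-≤ (determined z)) ⟩
    ∑ₚ (λ z → ∑ₚ (λ x → ε z * partner z x))
                                         ≡⟨ ∑ₚ-cong (λ z → *-distribˡ-∑ₚ (ε z) (partner z)) ⟨
    ∑ₚ (λ z → ε z * ∑ₚ (partner z))      ≡⟨ ∑ₚ-cong (λ z → cong (ε z *_) (∑-partner z)) ⟩
    ∑ₚ (λ z → ε z * ∣ nonUnits R ∣)      ≡⟨ *-distribʳ-∑ₚ ∣ nonUnits R ∣ ε ⟨
    e * ∣ nonUnits R ∣                   ∎
    where
    open ≤-Reasoning
    partner : Point N → Point N → ℕ
    partner z@(c , _) (a , b) = 𝟙 (not (isUnit (a -ᵣ c))) * δ (intercept s z +ᵣ s *ᵣ a) b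
    rearrange : ∀ p q w → p * (q * 1 * w) ≡ q * (p * w)
    rearrange = solve-∀
    determined : ∀ z x → nonUnitPair s z x ≤ ε z * partner z x
    determined z@(c , _) x@(a , b) = begin
      𝟙 nu * (ε z * ε x * δ (intercept s z) (intercept s x))
        ≤⟨ *-monoʳ-≤ (𝟙 nu) (*-mono-≤ (*-monoʳ-≤ (ε z) (𝟙≤1 (E a b))) (δ-mono (λ same → on-line s (sym same)))) ⟩
      𝟙 nu * (ε z * 1 * δ (intercept s z +ᵣ s *ᵣ a) b)
        ≡⟨ rearrange (𝟙 nu) (ε z) (δ (intercept s z +ᵣ s *ᵣ a) b) ⟩
      ε z * partner z x ∎
      where nu = not (isUnit (a -ᵣ c))
    ∑-partner : ∀ z → ∑ₚ (partner z) ≡ ∣ nonUnits R ∣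
    ∑-partner z@(c , _) = begin-equality
      sum (λ a → sum (λ b → 𝟙 (nu a) * δ (t a) b))   ≡⟨ sum-cong-≗ (λ a → *-distribˡ-sum (𝟙 (nu a)) (δ (t a))) ⟨
      sum (λ a → 𝟙 (nu a) * sum (δ (t a)))           ≡⟨ sum-cong-≗ (λ a → cong (𝟙 (nu a) *_) (∑-δ (t a))) ⟩
      sum (λ a → 𝟙 (nu a) * 1)                       ≡⟨ sum-cong-≗ (λ a → *-identityʳ (𝟙 (nu a))) ⟩
      sum (λ a → 𝟙 (nu a))                           ≡⟨ nonUnitCount c ⟩
      ∣ nonUnits R ∣                                 ∎
      where
      nu : Fin N → Bool
      nu a = not (isUnit (a -ᵣ c))
      t : Fin N → Fin N
      t a = intercept s z +ᵣ s *ᵣ a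

  lines : Fin N → ℕ
  lines s = supportSize (fibre s)

  e²≤lines*collisions : ∀ s → e * e ≤ lines s * collisions s
  e²≤lines*collisions s = subst (λ n → n * n ≤ lines s * collisions s) (∑-fibre≡e s) (sum²≤supportSize*∑² (fibre s))

  lines≤N : ∀ s → lines s ≤ N
  lines≤N s = ≤-trans (sum-mono-≤ (λ t → 𝟙≤1 (0 <ᵇ fibre s t))) (≤-reflexive (trans (sum-const N 1) (*-identityʳ N)))

  lines≤∣V₂∣ : ∀ s {a b c d i} → (a -ᵣ c) *ᵣ i ≡ 1# R → intercept s (a , b) ≡ intercept s (c , d) →
               E a b ≡ true → lines s ≤ ∣ V₂ R E c d ∣
  lines≤∣V₂∣ s {a} {b} {c} {d} inverse same Eab = begin
    sum (λ t → 𝟙 (0 <ᵇ fibre s t))  ≤⟨ sum-mono-≤ hit ⟩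
    sum (λ t → 𝟙 (lookup V (φ t)))  ≡⟨ sum-affine (λ y → 𝟙 (lookup V y)) ℓz inverse ⟩
    sum (λ y → 𝟙 (lookup V y))      ≡⟨ ∣p∣≡∑𝟙p V ⟨
    ∣ V ∣                           ∎
    where
    open ≤-Reasoning
    V = V₂ R E c d
    ℓz = intercept s (c , d)
    φ : Fin N → Fin N
    φ t = (a -ᵣ c) *ᵣ (t -ᵣ ℓz)
    in-V : ∀ a′ b′ → E a′ b′ ≡ true → lookup V (φ (intercept s (a′ , b′))) ≡ true
    in-V a′ b′ Ea′b′ = trans (lookup∘tabulate _ (φ (intercept s (a′ , b′))))
      (Equivalence.to T-≡ (fromWitness (a , b , a′ , b′ , both-in-E , det-along-line s a′ b′ same)))
      where
      both-in-E : E a b ∧ E a′ b′ ≡ true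
      both-in-E = cong₂ _∧_ Eab Ea′b′
    hit : ∀ t → 𝟙 (0 <ᵇ fibre s t) ≤ 𝟙 (lookup V (φ t))
    hit t with fibre s t in fibre≡
    ... | zero  = z≤n
    ... | suc _ with ∑ₚ-pos⇒∃-pos (λ x → ε x * δ (intercept s x) t) (subst (0 <_) (sym fibre≡) (s≤s z≤n))
    ...   | (a′ , b′) , on-t with m*n>0⇒m>0×n>0 (ε (a′ , b′)) _ on-t
    ...     | E>0 , δ>0 rewrite sym (δ-pos⇒≡ δ>0) | in-V a′ b′ (𝟙-pos⇒true E>0) = ≤-refl

  unitCollision⇒lines≤∣V₂∣ : ∀ s → 0 < unitCollisions s →
                             ∃₂ λ z1 z2 → E z1 z2 ≡ true × lines s ≤ ∣ V₂ R E z1 z2 ∣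
  unitCollision⇒lines≤∣V₂∣ s up>0 with ∑ₚ-pos⇒∃-pos _ up>0
  ... | (c , d) , ∑x>0 with ∑ₚ-pos⇒∃-pos _ ∑x>0
  ... | (a , b) , pair>0 with m*n>0⇒m>0×n>0 (𝟙 (isUnit (a -ᵣ c))) (collinear s (c , d) (a , b)) pair>0
  ... | unit>0 , collinear>0 with collinear-pos s collinear>0 | isUnit⇒inverse (a -ᵣ c) (𝟙-pos⇒true unit>0)
  ... | Ecd , Eab , same | i , inverse = c , d , Ecd , lines≤∣V₂∣ s inverse (sym same) Eab

  module _ (k : ℕ) where

    GoodSlope : Fin N → Set
    GoodSlope s = 0 < unitCollisions s × k * N * collisions s ≤ suc k * (e * e)

    goodSlope⇒largeV₂ : ∀ s → GoodSlope s → ∃₂ λ z1 z2 → E z1 z2 ≡ true × k * N ≤ suc k * ∣ V₂ R E z1 z2 ∣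
    goodSlope⇒largeV₂ s (up>0 , few) =
      let z1 , z2 , Ez , lines≤V = unitCollision⇒lines≤∣V₂∣ s up>0
      in  z1 , z2 , Ez , ≤-trans kN≤K·lines (*-monoʳ-≤ (suc k) lines≤V)
      where
      open ≤-Reasoning
      collisions>0 : 0 < collisions s
      collisions>0 = <-≤-trans up>0 (subst (unitCollisions s ≤_) (sym (collisions≡unit+nonUnit s)) (m≤m+n _ _))
      kN≤K·lines : k * N ≤ suc k * lines s
      kN≤K·lines = *-cancelʳ-≤ (k * N) (suc k * lines s) (collisions s) {{>-nonZero collisions>0}} (begin
        k * N * collisions s              ≤⟨ few ⟩
        suc k * (e * e)                   ≤⟨ *-monoʳ-≤ (suc k) (e²≤lines*collisions s) ⟩
        suc k * (lines s * collisions s)  ≡⟨ *-assoc (suc k) (lines s) (collisions s) ⟨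
        suc k * lines s * collisions s    ∎)

    badSlope-bound : ∀ s → ¬ GoodSlope s →
                     suc k * (e * e) ≤ k * (N * unitCollisions s) + suc k * (N * nonUnitCollisions s)
    badSlope-bound s notGood with unitCollisions s | collisions≡unit+nonUnit s
    ... | zero | col≡ = begin
      suc k * (e * e)                   ≤⟨ *-monoʳ-≤ (suc k) (e²≤lines*collisions s) ⟩
      suc k * (lines s * collisions s)  ≤⟨ *-monoʳ-≤ (suc k) (*-monoˡ-≤ (collisions s) (lines≤N s)) ⟩
      suc k * (N * collisions s)        ≡⟨ cong (λ c → suc k * (N * c)) col≡ ⟩
      suc k * (N * nonUnitCollisions s) ≤⟨ m≤n+m _ (k * (N * 0)) ⟩
      k * (N * 0) + suc k * (N * nonUnitCollisions s) ∎
      where open ≤-Reasoning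
    ... | suc u | col≡ = begin
      suc k * (e * e)                                  ≤⟨ <⇒≤ (≰⇒> (λ few → notGood (s≤s z≤n , few))) ⟩
      k * N * collisions s                             ≡⟨ cong (k * N *_) col≡ ⟩
      k * N * (suc u + nonUnitCollisions s)            ≡⟨ distribute k N (suc u) (nonUnitCollisions s) ⟩
      k * (N * suc u) + k * (N * nonUnitCollisions s)  ≤⟨ +-monoʳ-≤ (k * (N * suc u)) (*-monoˡ-≤ _ (n≤1+n k)) ⟩
      k * (N * suc u) + suc k * (N * nonUnitCollisions s) ∎
      where
      open ≤-Reasoning
      distribute : ∀ k n u v → k * n * (u + v) ≡ k * (n * u) + k * (n * v)
      distribute = solve-∀

    no-goodSlope⇒e≤ : (∀ s → ¬ GoodSlope s) → 0 < N → e ≤ suc k * (∣ nonUnits R ∣ * N)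
    no-goodSlope⇒e≤ none N>0 = quadratic-cancel k N e ∣ nonUnits R ∣ N>0 (begin
      N * (suc k * (e * e))
        ≡⟨ sum-const N (suc k * (e * e)) ⟨
      sum {N} (λ _ → suc k * (e * e))
        ≤⟨ sum-mono-≤ (λ s → badSlope-bound s (none s)) ⟩
      sum (λ s → k * (N * unitCollisions s) + suc k * (N * nonUnitCollisions s))
        ≡⟨ ∑-distrib-+ (λ s → k * (N * unitCollisions s)) (λ s → suc k * (N * nonUnitCollisions s)) ⟩
      sum (λ s → k * (N * unitCollisions s)) + sum (λ s → suc k * (N * nonUnitCollisions s))
        ≡⟨ cong₂ _+_ (scale k unitCollisions) (scale (suc k) nonUnitCollisions) ⟩
      k * (N * sum unitCollisions) + suc k * (N * sum nonUnitCollisions)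
        ≤⟨ +-mono-≤ (*-monoʳ-≤ k (*-monoʳ-≤ N ∑-unitCollisions≤e²))
                    (*-monoʳ-≤ (suc k) (*-monoʳ-≤ N ∑-nonUnitCollisions≤)) ⟩
      k * (N * (e * e)) + suc k * (N * (N * (e * ∣ nonUnits R ∣)))
        ∎)
      where
      open ≤-Reasoning
      scale : ∀ c f → sum (λ s → c * (N * f s)) ≡ c * (N * sum f)
      scale c f = trans (sym (*-distribˡ-sum c (λ s → N * f s))) (cong (c *_) (sym (*-distribˡ-sum N f)))
      ∑-nonUnitCollisions≤ : sum nonUnitCollisions ≤ N * (e * ∣ nonUnits R ∣)
      ∑-nonUnitCollisions≤ = ≤-trans (sum-mono-≤ nonUnitCollisions≤e*m) (≤-reflexive (sum-const N (e * ∣ nonUnits R ∣)))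

  largeV₂ : ∀ k → 0 < ∣ nonUnits R ∣ * N → suc (suc k) * (∣ nonUnits R ∣ * N) ≤ e →
            ∃₂ λ z1 z2 → E z1 z2 ≡ true × k * N ≤ suc k * ∣ V₂ R E z1 z2 ∣
  largeV₂ k mN>0 large with any? (λ s → (1 ≤? unitCollisions s) ×-dec (k * N * collisions s ≤? suc k * (e * e)))
  ... | yes (s , good) = goodSlope⇒largeV₂ k s good
  ... | no none = contradiction (+-cancelʳ-≤ (suc k * mN) mN 0 (≤-trans large small)) (<⇒≱ mN>0)
    where
    mN = ∣ nonUnits R ∣ * N
    small : e ≤ suc k * mN
    small = no-goodSlope⇒e≤ k (λ s good → none (s , good)) (proj₂ (m*n>0⇒m>0×n>0 ∣ nonUnits R ∣ N mN>0))

valuationRing-largeV₂ : ∀ k {N} (R : FinCommRing N) {q r} → IsFiniteValuationRing R q r → (E : Subset² N) →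
                        suc (suc k) * q ^ (2 * r ∸ 1) ≤ card² E →
                        ∃₂ λ z1 z2 → (E z1 z2 ≡ true) × (k * q ^ r ≤ suc k * ∣ V₂ R E z1 z2 ∣)
valuationRing-largeV₂ k {N} R {q} {r} valuationRing E large =
  let z1 , z2 , Ez , bound = largeV₂ k mN>0 (subst₂ (λ a b → suc (suc k) * a ≤ b) (sym mN≡q^[2r∸1]) card²≡e large)
  in  z1 , z2 , Ez , subst (λ n → k * n ≤ suc k * ∣ V₂ R E z1 z2 ∣) order bound
  where
  open IsFiniteValuationRing valuationRing using (residue; order)
  open Collisions R E using (largeV₂; card²≡e)
  N>0 : 0 < N
  N>0 = >-nonZero⁻¹ N {{nonZeroIndex (0# R)}}
  instance
    q≢0 : NonZero q
    q≢0 = >-nonZero (proj₁ (m*n>0⇒m>0×n>0 q ∣ nonUnits R ∣ (subst (0 <_) (sym residue) N>0)))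
  mN≡q^[2r∸1] : ∣ nonUnits R ∣ * N ≡ q ^ (2 * r ∸ 1)
  mN≡q^[2r∸1] = trans (cong (∣ nonUnits R ∣ *_) order) (q*m≡q^r⇒m*q^r≡q^[2r∸1] ∣ nonUnits R ∣ r (trans residue order))
  mN>0 : 0 < ∣ nonUnits R ∣ * N
  mN>0 = subst (0 <_) (sym mN≡q^[2r∸1]) (m^n>0 q (2 * r ∸ 1))

theorem1p3 : ∀ (k : ℕ) → ∃₂ λ (C Q : ℕ) →
    ∀ {N : ℕ} (R : FinCommRing N) (q r : ℕ) → IsFiniteValuationRing R q r → Q ≤ q →
    (E : Subset² N) → C * q ^ (2 * r ∸ 1) ≤ card² E →
    ∃₂ λ z1 z2 → (E z1 z2 ≡ true) × (k * q ^ r ≤ suc k * ∣ V₂ R E z1 z2 ∣)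
theorem1p3 k = suc (suc k) , 0 , λ R q r valuationRing _ → valuationRing-largeV₂ k R valuationRing
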